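{- Let $\Psi\in\{\mathfrak F,\mathfrak B\}$, let $\alpha,\beta$ satisfy $2<\alpha\le 3$ and $4\alpha-\beta=6$, and let $G\in\mathcal G(\Psi,\alpha,\beta)$. Then $|G|\ge 7$.
   Context: All graphs are finite and simple. $|G|$ is the number of vertices, $e(G)$ the number of edges, $G|_X$ the subgraph induced on $X$. $q_{\alpha,\beta}(G)=\alpha|G|-e(G)-\beta$. $\mathfrak F$ is the class of forests and $\mathfrak B$ the class of bipartite graphs. A vertex cut is a vertex set whose removal disconnects the graph; a $\Psi$-cut of $G$ is a vertex cut $M$ with $G|_M\in\Psi$. $\mathcal G(\Psi,\alpha,\beta)$ is the set of graphs $G$ such that $|G|\ge4$, $q_{\alpha,\beta}(G)>0$, $G$ has no $\Psi$-cut, and $G$ has the smallest number of vertices among all graphs with these three properties.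
   Formalization: The parameters α and β range over the rationals. -}

module Defs where

open import Data.Bool using (Bool; true; false; if_then_else_; _∧_)
open import Data.Nat as ℕ using (ℕ; zero; suc; _<ᵇ_)
open import Data.Fin using (Fin; zero; suc; toℕ; inject₁; fromℕ)
open import Data.Fin.Subset using (Subset; _∈_; _∉_; ∁)
open import Data.List using (List; map; allFin)
open import Data.Nat.ListAction using (sum)
open import Data.Integer using (+_)
open import Data.Rational using (ℚ; _/_; _*_; _-_; _<_; _≤_; 0ℚ)
open import Data.Product using (Σ; ∃; ∃-syntax; _×_)
open import Relation.Nullary using (¬_)
open import Relation.Binary.PropositionalEquality using (_≡_; _≢_)
open import Function.Definitions using (Injective)

record Graph (n : ℕ) : Set where
  field
    adj    : Fin n → Fin n → Bool
    sym    : ∀ u v → adj u v ≡ adj v u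
    irrefl : ∀ u → adj u u ≡ false
open Graph public

order : ∀ {n} → Graph n → ℕ
order {n} _ = n

edges : ∀ {n} → Graph n → ℕ
edges {n} G =
  sum (map (λ u → sum (map (λ v → if (toℕ u <ᵇ toℕ v) ∧ adj G u v then 1 else 0)
                           (allFin n)))
           (allFin n))

ℕ→ℚ : ℕ → ℚ
ℕ→ℚ m = (+ m) / 1

q : ℚ → ℚ → ∀ {n} → Graph n → ℚ
q α β G = α * ℕ→ℚ (order G) - ℕ→ℚ (edges G) - β

-- Reachability inside the vertex set S (paths using only vertices of S).
-- Reach G S u v: there is a walk from u to v all of whose vertices after u lie in S.
data Reach {n} (G : Graph n) (S : Subset n) (u : Fin n) : Fin n → Set where
  here : Reach G S u u
  step : ∀ {w v} → Reach G S u w → adj G w v ≡ true → v ∈ S → Reach G S u v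

IsVertexCut : ∀ {n} → Graph n → Subset n → Set
IsVertexCut {n} G M =
  ∃[ u ] ∃[ v ] (u ∉ M × v ∉ M × ¬ Reach G (∁ M) u v)

InducedBipartite : ∀ {n} → Graph n → Subset n → Set
InducedBipartite {n} G M =
  Σ (Fin n → Bool) λ col → (∀ (u v : Fin n) → u ∈ M → v ∈ M → adj G u v ≡ true → col u ≢ col v)

record InducedCycle {n} (G : Graph n) (M : Subset n) : Set where
  field
    k      : ℕ
    f      : Fin (suc (suc (suc k))) → Fin n
    inj    : Injective _≡_ _≡_ f
    inM    : ∀ i → f i ∈ M
    path   : ∀ (i : Fin (suc (suc k))) → adj G (f (inject₁ i)) (f (suc i)) ≡ true
    closed : adj G (f (fromℕ (suc (suc k)))) (f zero) ≡ true

InducedForest : ∀ {n} → Graph n → Subset n → Set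
InducedForest G M = ¬ InducedCycle G M

data GraphClass : Set where
  𝔉 𝔅 : GraphClass

InducedIn : GraphClass → ∀ {n} → Graph n → Subset n → Set
InducedIn 𝔉 G M = InducedForest G M
InducedIn 𝔅 G M = InducedBipartite G M

IsΨCut : GraphClass → ∀ {n} → Graph n → Subset n → Set
IsΨCut Ψ G M = IsVertexCut G M × InducedIn Ψ G M

Admissible : GraphClass → ℚ → ℚ → ∀ {n} → Graph n → Set
Admissible Ψ α β {n} G =
  (4 ℕ.≤ n) × (0ℚ < q α β G) × (∀ (M : Subset n) → ¬ IsΨCut Ψ G M)

Inℊ : GraphClass → ℚ → ℚ → ∀ {n} → Graph n → Set
Inℊ Ψ α β {n} G =
  Admissible Ψ α β G × (∀ (m : ℕ) (H : Graph m) → Admissible Ψ α β H → n ℕ.≤ m)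

-- For n = |G| ≥ 4, 4α − β = 6 and α ≤ 3 give q(G) = 6 + (n − 4)α − e(G) ≤ 3n − 6 − e(G),
-- so q(G) > 0 forces e(G) ≤ 3n − 7.  For n ∈ {4, 5, 6} every graph with at most 3n − 7
-- edges has a vertex cut inducing a forest, hence also a bipartite graph: the
-- neighbourhood of a vertex or of an edge.  This is checked on all graphs with 4, 5 and 6
-- vertices by a search whose answers carry certificates: M separates C from the rest
-- when every edge leaving C ends in M; G|_M is acyclic when repeatedly deleting leaves
-- empties M; and colouring each deleted leaf opposite to its neighbour gives a
-- 2-colouring of G|_M that is then checked to be proper.
module Submission where

open import Defs
open import Data.Nat using (ℕ; _≤_)
open import Data.Integer using (+_)
open import Data.Rational using (ℚ; _<_; _-_; _*_) renaming (_≤_ to _≤ℚ_)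
open import Data.Product using (_×_)
open import Relation.Binary.PropositionalEquality using (_≡_)

open import Data.Bool using (Bool; true; false; not; _∧_; _∨_; _xor_; if_then_else_; T)
open import Data.Bool.ListAction using (all; any)
open import Data.Bool.Properties using (T-≡; T-∧; T-∨)
open import Data.Empty using (⊥-elim)
open import Data.Fin using (Fin; zero; suc; toℕ; inject₁; fromℕ; _≟_)
open import Data.Fin.Properties using (toℕ-inject₁)
open import Data.Fin.Relation.Unary.Top using (view; ‵fromℕ; ‵inject₁)
open import Data.Fin.Subset using (Subset; _∈_; _∉_; ∁; outside)
open import Data.Fin.Subset.Properties using (_∈?_; x∈∁p⇒x∉p)
import Data.Integer as ℤ
import Data.Integer.Properties as ℤP
open import Data.List using (List; _∷_; map; findᵇ; allFin)
open import Data.List.Membership.Propositional.Properties using (∈-allFin)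
open import Data.List.Properties using (map-cong)
import Data.List.Relation.Unary.All as All
open import Data.List.Relation.Unary.All.Properties using (all⁺)
open import Data.List.Relation.Unary.Any using (satisfied)
open import Data.List.Relation.Unary.Any.Properties using (any⁻)
open import Data.Maybe using (Maybe; just; nothing; maybe)
import Data.Maybe as Maybe
open import Data.Maybe.Properties using (just-injective)
import Data.Nat as ℕ
import Data.Nat.Coprimality as Coprime
open import Data.Nat.ListAction using (sum)
import Data.Nat.Properties as ℕP
import Data.Rational as ℚ
import Data.Rational.Properties as ℚP
open import Data.Rational.Solver using (module +-*-Solver)
open import Data.Product using (∃; ∃₂; _,_; proj₁; proj₂)
open import Data.Sum using (_⊎_; inj₁; inj₂)
open import Data.Unit using (⊤; tt)
open import Data.Vec using (Vec; []; _∷_; lookup; tabulate; replicate; _[_]≔_)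
open import Data.Vec.Properties using (lookup∘tabulate; []≔-minimal)
open import Function using (_∘_)
open import Function.Bundles using (module Equivalence)
open import Relation.Nullary using (¬_)
open import Relation.Nullary.Decidable using (isYes; toWitness; fromWitness)
import Relation.Binary.PropositionalEquality as ≡
open ≡ using (_≢_; refl; cong; cong₂; trans; subst)

-- The edge bound

ℕ→ℚ≡mkℚ : ∀ m → ℕ→ℚ m ≡ ℚ.mkℚ (+ m) 0 (Coprime.sym (Coprime.1-coprimeTo m))
ℕ→ℚ≡mkℚ m = ℚP.normalize-coprime (Coprime.sym (Coprime.1-coprimeTo m))

ℕ→ℚ-+ : ∀ m k → ℕ→ℚ (m ℕ.+ k) ≡ ℕ→ℚ m ℚ.+ ℕ→ℚ k
ℕ→ℚ-+ m k rewrite ℕ→ℚ≡mkℚ m | ℕ→ℚ≡mkℚ k =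
  ≡.sym (cong₂ (λ x y → (x ℤ.+ y) ℚ./ 1) (ℤP.*-identityʳ (+ m)) (ℤP.*-identityʳ (+ k)))

ℕ→ℚ-* : ∀ m k → ℕ→ℚ (m ℕ.* k) ≡ ℕ→ℚ m * ℕ→ℚ k
ℕ→ℚ-* m k rewrite ℕ→ℚ≡mkℚ m | ℕ→ℚ≡mkℚ k = cong (ℚ._/ 1) (ℤP.pos-* m k)

ℕ→ℚ-mono-≤ : ∀ {m k} → m ≤ k → ℕ→ℚ m ≤ℚ ℕ→ℚ k
ℕ→ℚ-mono-≤ {m} {k} m≤k rewrite ℕ→ℚ≡mkℚ m | ℕ→ℚ≡mkℚ k =
  ℚ.*≤* (≡.subst₂ ℤ._≤_ (≡.sym (ℤP.*-identityʳ (+ m))) (≡.sym (ℤP.*-identityʳ (+ k))) (ℤ.+≤+ m≤k))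

ℕ→ℚ-cancel-< : ∀ {m k} → ℕ→ℚ m < ℕ→ℚ k → m ℕ.< k
ℕ→ℚ-cancel-< m<k = ℕP.≰⇒> λ k≤m → ℚP.<-irrefl refl (ℚP.<-≤-trans m<k (ℕ→ℚ-mono-≤ k≤m))

0<p-q⇒q<p : ∀ {p q} → ℚ.0ℚ < p - q → q < p
0<p-q⇒q<p {p} {q} 0<p-q =
  ≡.subst₂ _<_ (ℚP.+-identityˡ q) (solve 2 (λ p q → (p :- q) :+ q := p) refl p q) (ℚP.+-monoˡ-< q 0<p-q)
  where open +-*-Solver

module _ {α β : ℚ} (α≤3 : α ≤ℚ ℕ→ℚ 3) (4α-β≡6 : ℕ→ℚ 4 * α - β ≡ ℕ→ℚ 6) where

  q-bound : ∀ k e → α * ℕ→ℚ (4 ℕ.+ k) - ℕ→ℚ e - β ≤ℚ ℕ→ℚ (6 ℕ.+ 3 ℕ.* k) - ℕ→ℚ e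
  q-bound k e = begin
    α * ℕ→ℚ (4 ℕ.+ k) - E - β         ≡⟨ cong (λ x → α * x - E - β) (ℕ→ℚ-+ 4 k) ⟩
    α * (ℕ→ℚ 4 ℚ.+ K) - E - β         ≡⟨ solve 4 (λ α β K E → α :* (con (ℕ→ℚ 4) :+ K) :- E :- β
                                           := (con (ℕ→ℚ 4) :* α :- β) :+ α :* K :- E) refl α β K E ⟩
    (ℕ→ℚ 4 * α - β) ℚ.+ α * K - E     ≡⟨ cong (λ x → x ℚ.+ α * K - E) 4α-β≡6 ⟩
    ℕ→ℚ 6 ℚ.+ α * K - E               ≤⟨ ℚP.+-monoˡ-≤ (ℚ.- E) (ℚP.+-monoʳ-≤ (ℕ→ℚ 6) (ℚP.*-monoʳ-≤-nonNeg K α≤3)) ⟩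
    ℕ→ℚ 6 ℚ.+ ℕ→ℚ 3 * K - E           ≡⟨ cong (_- E) (≡.trans (ℕ→ℚ-+ 6 (3 ℕ.* k)) (cong (ℕ→ℚ 6 ℚ.+_) (ℕ→ℚ-* 3 k))) ⟨
    ℕ→ℚ (6 ℕ.+ 3 ℕ.* k) - E           ∎
    where
    open ℚP.≤-Reasoning
    open +-*-Solver
    K = ℕ→ℚ k
    E = ℕ→ℚ e
    instance
      K≥0 : ℚ.NonNegative K
      K≥0 = ℚ.nonNegative (ℕ→ℚ-mono-≤ {0} {k} ℕ.z≤n)

  edges-bound : ∀ k (G : Graph (4 ℕ.+ k)) → ℚ.0ℚ < q α β G → edges G ℕ.+ 7 ≤ 3 ℕ.* (4 ℕ.+ k)
  edges-bound k G 0<q = begin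
    edges G ℕ.+ 7            ≡⟨ ℕP.+-comm (edges G) 7 ⟩
    6 ℕ.+ ℕ.suc (edges G)    ≤⟨ ℕP.+-monoʳ-≤ 6 e<6+3k ⟩
    6 ℕ.+ (6 ℕ.+ 3 ℕ.* k)    ≡⟨ ℕP.*-distribˡ-+ 3 4 k ⟨
    3 ℕ.* (4 ℕ.+ k)          ∎
    where
    open ℕP.≤-Reasoning
    e<6+3k : edges G ℕ.< 6 ℕ.+ 3 ℕ.* k
    e<6+3k = ℕ→ℚ-cancel-< (0<p-q⇒q<p (ℚP.<-≤-trans 0<q (q-bound k (edges G))))

infixr 3 _⇒ᵇ_
_⇒ᵇ_ : Bool → Bool → Bool
true  ⇒ᵇ y = y
false ⇒ᵇ _ = true

⇒ᵇ-elim : ∀ {x y} → T (x ⇒ᵇ y) → T x → T y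
⇒ᵇ-elim {true} y _ = y

not-elim : ∀ {x} → T (not x) → ¬ T x
not-elim {false} _ ()

xor⇒≢ : ∀ {x y} → T (x xor y) → x ≢ y
xor⇒≢ {false} {true}  _ ()
xor⇒≢ {true}  {false} _ ()

∧-elim : ∀ {x y} → T (x ∧ y) → T x × T y
∧-elim = Equivalence.to T-∧

∧-intro : ∀ {x y} → T x × T y → T (x ∧ y)
∧-intro = Equivalence.from T-∧

∨-intro : ∀ {x y} → T x ⊎ T y → T (x ∨ y)
∨-intro = Equivalence.from T-∨

∨-resolve : ∀ {x y} → T (x ∨ y) → ¬ T y → T x
∨-resolve {true}  _ _  = _
∨-resolve {false} y ¬y = ⊥-elim (¬y y)

∀ᵇ : ∀ {n} → (Fin n → Bool) → Bool
∀ᵇ p = all p (allFin _)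

∃ᵇ : ∀ {n} → (Fin n → Bool) → Bool
∃ᵇ p = any p (allFin _)

∀ᵇ-sound : ∀ {n} {p : Fin n → Bool} → T (∀ᵇ p) → ∀ i → T (p i)
∀ᵇ-sound {p = p} h i = All.lookup (all⁺ p (allFin _) h) (∈-allFin i)

∃ᵇ-sound : ∀ {n} {p : Fin n → Bool} → T (∃ᵇ p) → ∃ λ i → T (p i)
∃ᵇ-sound {p = p} h = satisfied (any⁻ p (allFin _) h)

findᵇ-sound : ∀ {A : Set} (p : A → Bool) (xs : List A) {x} → findᵇ p xs ≡ just x → T (p x)
findᵇ-sound p (y ∷ ys) found with p y in py
... | true  = subst (T ∘ p) (just-injective found) (Equivalence.from T-≡ py)
... | false = findᵇ-sound p ys found

infix 7 _∈ᵇ_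
_∈ᵇ_ : ∀ {n} → Fin n → Subset n → Bool
x ∈ᵇ M = isYes (x ∈? M)

cycle-neighbours : ∀ {n} {G : Graph n} {M} (cyc : InducedCycle G M) → let open InducedCycle cyc in
  ∀ i → ∃₂ λ j j′ → j ≢ j′ × adj G (f i) (f j) ≡ true × adj G (f i) (f j′) ≡ true
cycle-neighbours {G = G} cyc zero = suc zero , fromℕ _ , (λ ()) , path zero , trans (sym G _ _) closed
  where open InducedCycle cyc
cycle-neighbours {G = G} cyc (suc i) with view i
... | ‵fromℕ = inject₁ (fromℕ _) , zero , (λ ()) , trans (sym G _ _) (path (fromℕ _)) , closed
  where open InducedCycle cyc
... | ‵inject₁ j = inject₁ (inject₁ j) , suc (suc j) , prev≢next , trans (sym G _ _) (path (inject₁ j)) , path (suc j)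
  where
  open InducedCycle cyc
  prev≢next : inject₁ (inject₁ j) ≢ suc (suc j)
  prev≢next eq = ℕP.m≢1+n+m (toℕ j) {1}
    (trans (≡.sym (trans (toℕ-inject₁ (inject₁ j)) (toℕ-inject₁ j))) (cong toℕ eq))

-- A certifying search for cuts around a vertex or an edge

Adj : ℕ → Set
Adj n = Fin n → Fin n → Bool

module NeighbourhoodCuts {n : ℕ} (a : Adj n) where

  neighbourIn : Subset n → Fin n → Maybe (Fin n)
  neighbourIn M x = findᵇ (λ y → y ∈ᵇ M ∧ a x y) (allFin n)

  isLeaf : Subset n → Fin n → Bool
  isLeaf M x = x ∈ᵇ M ∧ onlyNeighbour (neighbourIn M x)
    where
    onlyNeighbour : Maybe (Fin n) → Bool
    onlyNeighbour nothing  = ∀ᵇ λ z → not (z ∈ᵇ M ∧ a x z)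
    onlyNeighbour (just y) = ∀ᵇ λ z → z ∈ᵇ M ∧ a x z ⇒ᵇ isYes (z ≟ y)

  isEmpty : Subset n → Bool
  isEmpty M = ∀ᵇ λ z → not (z ∈ᵇ M)

  peel : ℕ → Subset n → Maybe (Vec Bool n)
  peel ℕ.zero    M = if isEmpty M then just (replicate n false) else nothing
  peel (ℕ.suc k) M = maybe (λ x → Maybe.map (paint x (M [ x ]≔ outside)) (peel k (M [ x ]≔ outside)))
                           (peel 0 M)
                           (findᵇ (isLeaf M) (allFin n))
    where
    paint : Fin n → Subset n → Vec Bool n → Vec Bool n
    paint x M′ col = col [ x ]≔ not (maybe (lookup col) false (neighbourIn M′ x))

  isProperColouring : Subset n → Vec Bool n → Bool
  isProperColouring M col = ∀ᵇ λ u → u ∈ᵇ M ⇒ᵇ ∀ᵇ λ v → v ∈ᵇ M ∧ a u v ⇒ᵇ lookup col u xor lookup col v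

  exitsInto : Subset n → Subset n → Bool
  exitsInto C M = ∀ᵇ λ x → x ∈ᵇ C ⇒ᵇ ∀ᵇ λ y → a x y ⇒ᵇ y ∈ᵇ C ∨ y ∈ᵇ M

  isCutWitness : Subset n → Subset n → Bool
  isCutWitness C M = ∃ᵇ (λ s → s ∈ᵇ C ∧ not (s ∈ᵇ M)) ∧ ∃ᵇ (λ t → not (t ∈ᵇ C ∨ t ∈ᵇ M)) ∧ exitsInto C M

  isΨCutWitness : Subset n → Subset n → Bool
  isΨCutWitness C M = isCutWitness C M ∧ maybe (isProperColouring M) false (peel n M)

  pair : Fin n → Fin n → Subset n
  pair v w = tabulate λ z → isYes (v ≟ z) ∨ isYes (w ≟ z)

  pairBoundary : Fin n → Fin n → Subset n
  pairBoundary v w = tabulate λ z → not (isYes (v ≟ z) ∨ isYes (w ≟ z)) ∧ (a v z ∨ a w z)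

  cutAround : Fin n → Fin n → Bool
  cutAround v w = isΨCutWitness (pair v w) (pairBoundary v w)

  hasNeighbourhoodCut : Bool
  hasNeighbourhoodCut = ∃ᵇ (λ v → cutAround v v) ∨ ∃ᵇ (λ v → ∃ᵇ λ w → a v w ∧ cutAround v w)

module NeighbourhoodCutsSound {n} (G : Graph n) (a : Adj n) (a≗adj : ∀ u v → a u v ≡ adj G u v) where
  open NeighbourhoodCuts a

  T-adj : ∀ {u v} → adj G u v ≡ true → T (a u v)
  T-adj {u} {v} uv = Equivalence.from T-≡ (trans (a≗adj u v) uv)

  leaf-neighbour-unique : ∀ {M x y z} → T (isLeaf M x) → T (y ∈ᵇ M ∧ a x y) → T (z ∈ᵇ M ∧ a x z) → y ≡ z
  leaf-neighbour-unique {M} {x} {y} {z} leaf y∼x z∼x with neighbourIn M x | proj₂ (∧-elim {x ∈ᵇ M} leaf)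
  ... | just w  | unique = trans (toWitness {a? = y ≟ w} (⇒ᵇ-elim (∀ᵇ-sound unique y) y∼x))
                                 (≡.sym (toWitness {a? = z ≟ w} (⇒ᵇ-elim (∀ᵇ-sound unique z) z∼x)))
  ... | nothing | none   = ⊥-elim (not-elim (∀ᵇ-sound none y) y∼x)

  -- Both cycle-neighbours of a leaf would be its unique neighbour.
  cycle-avoids-leaf : ∀ {M x} → T (isLeaf M x) → InducedCycle G M → InducedCycle G (M [ x ]≔ outside)
  cycle-avoids-leaf {M} {x} leaf cyc =
    record { k = k ; f = f ; inj = inj ; inM = inM′ ; path = path ; closed = closed }
    where
    open InducedCycle cyc
    avoids : ∀ i → f i ≢ x
    avoids i refl with cycle-neighbours cyc i
    ... | j , j′ , j≢j′ , xj , xj′ =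
      j≢j′ (inj (leaf-neighbour-unique leaf (∧-intro (fromWitness (inM j) , T-adj xj))
                                           (∧-intro (fromWitness (inM j′) , T-adj xj′))))
    inM′ : ∀ i → f i ∈ M [ x ]≔ outside
    inM′ i = []≔-minimal M (f i) x (avoids i) (inM i)

  empty-acyclic : ∀ {M} → T (isEmpty M) → InducedForest G M
  empty-acyclic empty cyc = not-elim (∀ᵇ-sound empty (f zero)) (fromWitness (inM zero))
    where open InducedCycle cyc

  peel-acyclic : ∀ k M {col} → peel k M ≡ just col → InducedForest G M
  peel-acyclic ℕ.zero M peeled with isEmpty M in empty
  ... | true = empty-acyclic (Equivalence.from T-≡ empty)
  peel-acyclic (ℕ.suc k) M peeled with findᵇ (isLeaf M) (allFin n) in found
  ... | nothing = peel-acyclic 0 M peeled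
  ... | just x with peel k (M [ x ]≔ outside) in rest
  ...   | just _ =
    peel-acyclic k (M [ x ]≔ outside) rest ∘ cycle-avoids-leaf (findᵇ-sound (isLeaf M) (allFin n) found)

  proper-bipartite : ∀ {M col} → T (isProperColouring M col) → InducedBipartite G M
  proper-bipartite {M} {col} proper = lookup col , λ u v u∈M v∈M uv →
    xor⇒≢ (⇒ᵇ-elim (∀ᵇ-sound (⇒ᵇ-elim (∀ᵇ-sound proper u) (fromWitness u∈M)) v)
                   (∧-intro (fromWitness v∈M , T-adj uv)))

  reach-stays-in : ∀ {C M s w} → T (exitsInto C M) → T (s ∈ᵇ C) → Reach G (∁ M) s w → T (w ∈ᵇ C)
  reach-stays-in closed s∈C here = s∈C
  reach-stays-in {M = M} closed s∈C (step {w} {v} r wv v∈∁M) =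
    ∨-resolve (⇒ᵇ-elim (∀ᵇ-sound (⇒ᵇ-elim (∀ᵇ-sound closed w) (reach-stays-in closed s∈C r)) v) (T-adj wv))
              (x∈∁p⇒x∉p v∈∁M ∘ toWitness)

  cut-witness-sound : ∀ {C M} → T (isCutWitness C M) → IsVertexCut G M
  cut-witness-sound {C} {M} witness with ∧-elim {∃ᵇ (λ s → s ∈ᵇ C ∧ not (s ∈ᵇ M))} witness
  ... | source , rest with ∧-elim {∃ᵇ (λ t → not (t ∈ᵇ C ∨ t ∈ᵇ M))} rest
  ... | target , closed with ∃ᵇ-sound source | ∃ᵇ-sound target
  ... | s , s∈C∖M | t , t∉C∪M = s , t , s∉M , t∉M , t-unreachable
    where
    s∉M : s ∉ M
    s∉M = not-elim (proj₂ (∧-elim {s ∈ᵇ C} s∈C∖M)) ∘ fromWitness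
    t∉M : t ∉ M
    t∉M t∈M = not-elim t∉C∪M (∨-intro {t ∈ᵇ C} (inj₂ (fromWitness t∈M)))
    t-unreachable : ¬ Reach G (∁ M) s t
    t-unreachable r = not-elim t∉C∪M (∨-intro (inj₁ (reach-stays-in closed (proj₁ (∧-elim {s ∈ᵇ C} s∈C∖M)) r)))

  ΨCut-witness-sound : ∀ {C M} → T (isΨCutWitness C M) → ∀ Ψ → IsΨCut Ψ G M
  ΨCut-witness-sound {C} {M} witness Ψ with ∧-elim {isCutWitness C M} witness
  ... | cut , colourable with peel n M in peeled
  ... | just col = cut-witness-sound cut , induced Ψ
    where
    induced : ∀ Ψ → InducedIn Ψ G M
    induced 𝔉 = peel-acyclic n M peeled
    induced 𝔅 = proper-bipartite {col = col} colourable

  hasNeighbourhoodCut-sound : T hasNeighbourhoodCut → ∃ λ S → ∀ Ψ → IsΨCut Ψ G S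
  hasNeighbourhoodCut-sound found with Equivalence.to (T-∨ {∃ᵇ λ v → cutAround v v}) found
  ... | inj₁ around-vertex with ∃ᵇ-sound around-vertex
  ...   | v , cut = pairBoundary v v , ΨCut-witness-sound cut
  hasNeighbourhoodCut-sound found | inj₂ around-edge with ∃ᵇ-sound around-edge
  ...   | v , around-v with ∃ᵇ-sound around-v
  ...     | w , edge-cut = pairBoundary v w , ΨCut-witness-sound (proj₂ (∧-elim {a v w} edge-cut))

-- Enumerating all graphs on Fin n

-- A graph on Fin (suc n) is coded by the neighbours of vertex 0 among the
-- other vertices, followed by the code of the graph induced on them.
Code : ℕ → Set
Code ℕ.zero    = ⊤
Code (ℕ.suc n) = Vec Bool n × Code n

decode : ∀ {n} → Code n → Adj n
decode {ℕ.suc n} (r , c) zero    zero    = false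
decode {ℕ.suc n} (r , c) zero    (suc j) = lookup r j
decode {ℕ.suc n} (r , c) (suc i) zero    = lookup r i
decode {ℕ.suc n} (r , c) (suc i) (suc j) = decode c i j

encode : ∀ {n} → Adj n → Code n
encode {ℕ.zero}  a = tt
encode {ℕ.suc n} a = tabulate (a zero ∘ suc) , encode (λ i j → a (suc i) (suc j))

decode-encode : ∀ {n} (a : Adj n) → (∀ u v → a u v ≡ a v u) → (∀ u → a u u ≡ false) →
                ∀ u v → decode (encode a) u v ≡ a u v
decode-encode a a-sym a-irrefl zero    zero    = ≡.sym (a-irrefl zero)
decode-encode a a-sym a-irrefl zero    (suc j) = lookup∘tabulate (a zero ∘ suc) j
decode-encode a a-sym a-irrefl (suc i) zero    = trans (lookup∘tabulate (a zero ∘ suc) i) (a-sym zero (suc i))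
decode-encode a a-sym a-irrefl (suc i) (suc j) =
  decode-encode (λ i j → a (suc i) (suc j)) (λ u v → a-sym (suc u) (suc v)) (a-irrefl ∘ suc) i j

∀ᵛ : ∀ k → (Vec Bool k → Bool) → Bool
∀ᵛ ℕ.zero    P = P []
∀ᵛ (ℕ.suc k) P = ∀ᵛ k (P ∘ (false ∷_)) ∧ ∀ᵛ k (P ∘ (true ∷_))

∀ᵛ-sound : ∀ k {P} → T (∀ᵛ k P) → ∀ r → T (P r)
∀ᵛ-sound ℕ.zero    h []          = h
∀ᵛ-sound (ℕ.suc k) h (false ∷ r) = ∀ᵛ-sound k (proj₁ (∧-elim h)) r
∀ᵛ-sound (ℕ.suc k) h (true ∷ r)  = ∀ᵛ-sound k (proj₂ (∧-elim h)) r

∀ᶜ : ∀ n → (Code n → Bool) → Bool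
∀ᶜ ℕ.zero    P = P tt
∀ᶜ (ℕ.suc n) P = ∀ᵛ n λ r → ∀ᶜ n λ c → P (r , c)

∀ᶜ-sound : ∀ n {P} → T (∀ᶜ n P) → ∀ c → T (P c)
∀ᶜ-sound ℕ.zero    h tt      = h
∀ᶜ-sound (ℕ.suc n) h (r , c) = ∀ᶜ-sound n (∀ᵛ-sound n h r) c

-- Defs.edges G unfolds to edgeCount (adj G).
edgeCount : ∀ {n} → Adj n → ℕ
edgeCount {n} a =
  sum (map (λ u → sum (map (λ v → if (toℕ u ℕ.<ᵇ toℕ v) ∧ a u v then 1 else 0) (allFin n))) (allFin n))

edgeCount-cong : ∀ {n} {a b : Adj n} → (∀ u v → a u v ≡ b u v) → edgeCount a ≡ edgeCount b
edgeCount-cong {n} a≗b = cong sum (map-cong (λ u → cong sum (map-cong (λ v →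
  cong (λ x → if (toℕ u ℕ.<ᵇ toℕ v) ∧ x then 1 else 0) (a≗b u v)) (allFin n))) (allFin n))

cutIfSparse : ∀ n → Code n → Bool
cutIfSparse n c = edgeCount (decode c) ℕ.+ 7 ℕ.≤ᵇ 3 ℕ.* n ⇒ᵇ NeighbourhoodCuts.hasNeighbourhoodCut (decode c)

ΨCut-if-sparse : ∀ {n} → ∀ᶜ n (cutIfSparse n) ≡ true →
                 (G : Graph n) → edges G ℕ.+ 7 ≤ 3 ℕ.* n → ∃ λ S → ∀ Ψ → IsΨCut Ψ G S
ΨCut-if-sparse {n} checked G sparse =
  NeighbourhoodCutsSound.hasNeighbourhoodCut-sound G a a≗adj
    (⇒ᵇ-elim (∀ᶜ-sound n (Equivalence.from T-≡ checked) (encode (adj G)))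
             (ℕP.≤⇒≤ᵇ (subst (λ e → e ℕ.+ 7 ≤ 3 ℕ.* n) (edgeCount-cong λ u v → ≡.sym (a≗adj u v)) sparse)))
  where
  a = decode (encode (adj G))
  a≗adj = decode-encode (adj G) (sym G) (irrefl G)

sparse-graph-has-ΨCut : ∀ k → k ℕ.< 3 → (G : Graph (4 ℕ.+ k)) → edges G ℕ.+ 7 ≤ 3 ℕ.* (4 ℕ.+ k) →
                        ∃ λ S → ∀ Ψ → IsΨCut Ψ G S
-- Each refl runs the search on all graphs with 4 + k vertices.
sparse-graph-has-ΨCut 0 _ = ΨCut-if-sparse refl
sparse-graph-has-ΨCut 1 _ = ΨCut-if-sparse refl
sparse-graph-has-ΨCut 2 _ = ΨCut-if-sparse refl
sparse-graph-has-ΨCut (ℕ.suc (ℕ.suc (ℕ.suc _))) (ℕ.s≤s (ℕ.s≤s (ℕ.s≤s ())))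

lemma10 : (Ψ : GraphClass) (α β : ℚ) →
            ℕ→ℚ 2 < α → α ≤ℚ ℕ→ℚ 3 → ℕ→ℚ 4 * α - β ≡ ℕ→ℚ 6 →
            ∀ {n} (G : Graph n) → Inℊ Ψ α β G → 7 ≤ n
lemma10 Ψ α β _ α≤3 4α-β≡6 G ((ℕ.s≤s (ℕ.s≤s (ℕ.s≤s (ℕ.s≤s {n = k} _))) , 0<q , noΨCut) , _) =
  ℕP.≮⇒≥ λ n<7 →
    let S , S-is-ΨCut = sparse-graph-has-ΨCut k (ℕP.+-cancelˡ-< 4 k 3 n<7) G (edges-bound α≤3 4α-β≡6 k G 0<q)
    in noΨCut S (S-is-ΨCut Ψ)
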